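{- Let $c\ge 0$ be an integer and $M\in R(c)$, and let $g=\tilde h(M)$. Then $L(g)\in\mathrm{CH}_2^+$.
   Context: Let $\mathrm{CH}_2$ be the commutative ring which is a free $\mathbb{Z}$-module with basis $\{h_i : i\ge 0\}$ (with multiplication $h_ih_j=\sum_{k=0}^{\min(i,j)}h_{i+j-2k}$), and let $\mathrm{CH}_2^+$ be the set of finite sums $\sum_{i\ge0}c_ih_i$ with all $c_i\in\mathbb{Z}_{\ge0}$. Let $\tilde{\mathrm{CH}}_2$ be the free $\mathbb{Z}$-module with basis $\{\tilde h_i : i\in\mathbb{Z}\}$, and let $L:\tilde{\mathrm{CH}}_2\to \mathrm{CH}_2$ be the $\mathbb{Z}$-linear map with $L(\tilde h_{ -1})=0$, $L(\tilde h_i)=h_i$ for $i\ge 0$, $L(\tilde h_i)=-h_{ -i-2}$ for $i\le -2$. Multisets are finite multisets of integers; $\mathrm{mult}(i,M)$ is the multiplicity of $i$ in $M$; $\tilde h(M)=\sum_i\mathrm{mult}(i,M)\tilde h_i$; $\cup$ is multiset union. For integers $a\le b$, $a\equiv b\pmod 2$, $[a,b]=\{a,a+2,\dots,b\}$. For an integer $c$, $R(c)$ is the set of multisets of the form $\bigcup_{i=1}^{k_1}\{m_i\}\cup\bigcup_{i=1}^{k_2}[c-n_i,c+n_i]$ with integers $k_1,k_2\ge0$, $m_i\ge c$, $n_i\ge1$. -}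

module Defs where

open import Data.Nat using (ℕ; zero; suc)
import Data.Nat as ℕ
open import Data.Integer using (ℤ; +_; -[1+_]; _+_; _-_; _*_; _≤_; _≥_; 0ℤ; 1ℤ; -1ℤ)
open import Data.List using (List; []; _∷_; _++_; map; concatMap; upTo; foldr)
open import Data.List.Relation.Unary.All using (All)
open import Data.List.Relation.Binary.Permutation.Propositional using (_↭_)
open import Data.Product using (Σ; _×_)
open import Relation.Nullary.Decidable using (does)
open import Data.Bool using (if_then_else_)

-- Multisets of integers are represented by lists, considered up to
-- permutation (_↭_).  Multiset union is list concatenation.

-- An element of CH_2 is represented by its coefficient function
-- j ↦ (coefficient of h_j); elements arising here have finite support.
CH₂ : Set
CH₂ = ℕ → ℤ

zeroCH : CH₂
zeroCH _ = 0ℤ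

_⊕_ : CH₂ → CH₂ → CH₂
(f ⊕ g) j = f j + g j

h : ℕ → CH₂
h i j = if does (i ℕ.≟ j) then 1ℤ else 0ℤ

Lbasis : ℤ → CH₂
Lbasis (+ i) = h i
Lbasis -[1+ zero ] = zeroCH
Lbasis -[1+ suc k ] j = Data.Integer.- (h k j)   -- i = -(k+2), -i-2 = k

-- h̃(M) is the formal sum Σ_{x ∈ M} h̃_x; by Z-linearity
-- L(h̃(M)) = Σ_{x ∈ M} L(h̃_x).
Lh̃ : List ℤ → CH₂
Lh̃ M = foldr (λ x acc → Lbasis x ⊕ acc) zeroCH M

CH₂⁺ : CH₂ → Set
CH₂⁺ f = ∀ j → 0ℤ ≤ f j

interval : ℤ → ℕ → List ℤ
interval c n = map (λ k → (c - + n) + + (2 ℕ.* k)) (upTo (suc n))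

R : ℤ → List ℤ → Set
R c M = Σ (List ℤ) λ ms → Σ (List ℕ) λ ns →
          All (λ m → m ≥ c) ms × All (λ n → 1 ℕ.≤ n) ns ×
          (M ↭ (ms ++ concatMap (interval c) ns))

-- Every singleton {m} with m ≥ c ≥ 0 contributes h_m.  An interval [c-n, c+n] is
-- symmetric about c ≥ 0; if it dips below 0, its initial block [c-n, n-c-2] is
-- symmetric about -1, and since L(h̃_{-k-2}) = -h_k = -L(h̃_k) that block
-- contributes 0.  What remains, [n-c, c+n], consists of nonnegative indices.
module Submission where

open import Defs
open import Data.Nat using (ℕ; zero; suc)
import Data.Nat as N
import Data.Nat.Properties as NP
open import Data.Integer using (ℤ; +_; -[1+_]; _+_; _-_; -_; _≤_; +≤+; 0ℤ; _⊖_)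
open import Data.Integer.Properties
open import Data.List using (List; []; _∷_; _++_; [_]; concatMap; applyUpTo)
open import Data.List.Properties using (map-upTo)
open import Data.List.Relation.Unary.All as All using (All; []; _∷_)
open import Data.List.Relation.Binary.Permutation.Propositional using (_↭_; refl; prep; swap; trans)
open import Data.Product using (_,_)
open import Data.Bool using (true; false)
open import Relation.Nullary.Decidable using (does; yes; no)
open import Relation.Binary.PropositionalEquality as ≡
  using (_≡_; _≗_; cong; cong₂; sym; subst; subst₂)
open ≡.≡-Reasoning

h-nonneg : ∀ i → CH₂⁺ (h i)
h-nonneg i j with does (i N.≟ j)
... | true  = +≤+ N.z≤n
... | false = +≤+ N.z≤n

CH₂⁺-⊕ : ∀ {f g} → CH₂⁺ f → CH₂⁺ g → CH₂⁺ (f ⊕ g)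
CH₂⁺-⊕ f⁺ g⁺ j = +-mono-≤ (f⁺ j) (g⁺ j)

CH₂⁺-resp-≗ : ∀ {f g} → f ≗ g → CH₂⁺ f → CH₂⁺ g
CH₂⁺-resp-≗ f≗g f⁺ j = subst (0ℤ ≤_) (f≗g j) (f⁺ j)

Lbasis-reflect : ∀ k → Lbasis -[1+ suc k ] ⊕ Lbasis (+ k) ≗ zeroCH
Lbasis-reflect k j = +-inverseˡ (h k j)

Lh̃-++ : ∀ xs ys → Lh̃ (xs ++ ys) ≗ Lh̃ xs ⊕ Lh̃ ys
Lh̃-++ []       ys j = sym (+-identityˡ _)
Lh̃-++ (x ∷ xs) ys j = begin
  Lbasis x j + Lh̃ (xs ++ ys) j           ≡⟨ cong (_+_ (Lbasis x j)) (Lh̃-++ xs ys j) ⟩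
  Lbasis x j + (Lh̃ xs j + Lh̃ ys j)       ≡⟨ +-assoc (Lbasis x j) _ _ ⟨
  Lbasis x j + Lh̃ xs j + Lh̃ ys j         ∎

Lh̃-↭ : ∀ {xs ys} → xs ↭ ys → Lh̃ xs ≗ Lh̃ ys
Lh̃-↭ refl                   j = ≡.refl
Lh̃-↭ (prep x p)             j = cong (_+_ (Lbasis x j)) (Lh̃-↭ p j)
Lh̃-↭ (swap {xs} {ys} x y p) j = begin
  Lbasis x j + (Lbasis y j + Lh̃ xs j)    ≡⟨ +-assoc (Lbasis x j) _ _ ⟨
  Lbasis x j + Lbasis y j + Lh̃ xs j      ≡⟨ cong₂ _+_ (+-comm (Lbasis x j) _) (Lh̃-↭ p j) ⟩
  Lbasis y j + Lbasis x j + Lh̃ ys j      ≡⟨ +-assoc (Lbasis y j) _ _ ⟩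
  Lbasis y j + (Lbasis x j + Lh̃ ys j)    ∎
Lh̃-↭ (trans p q)            j = ≡.trans (Lh̃-↭ p j) (Lh̃-↭ q j)

Lh̃-nonneg : ∀ {xs} → All (0ℤ ≤_) xs → CH₂⁺ (Lh̃ xs)
Lh̃-nonneg {[]}            []      j = +≤+ N.z≤n
Lh̃-nonneg {+ i ∷ _}       (_ ∷ p) = CH₂⁺-⊕ (h-nonneg i) (Lh̃-nonneg p)
Lh̃-nonneg { -[1+ _ ] ∷ _ } (() ∷ _)

Lh̃-++-nonneg : ∀ xs ys → CH₂⁺ (Lh̃ xs) → CH₂⁺ (Lh̃ ys) → CH₂⁺ (Lh̃ (xs ++ ys))
Lh̃-++-nonneg xs ys xs⁺ ys⁺ = CH₂⁺-resp-≗ (λ j → sym (Lh̃-++ xs ys j)) (CH₂⁺-⊕ xs⁺ ys⁺)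

progression : ℤ → ℕ → List ℤ
progression a zero    = []
progression a (suc m) = a ∷ progression (a + + 2) m

a+2+2k≡a+2[1+k] : ∀ a k → a + + 2 + + (2 N.* k) ≡ a + + (2 N.* suc k)
a+2+2k≡a+2[1+k] a k = ≡.trans (+-assoc a (+ 2) _) (cong (λ n → a + + n) (sym (NP.*-suc 2 k)))

progression-++ : ∀ a m n → progression a (m N.+ n) ≡ progression a m ++ progression (a + + (2 N.* m)) n
progression-++ a zero    n = cong (λ b → progression b n) (sym (+-identityʳ a))
progression-++ a (suc m) n = cong (a ∷_) (begin
  progression (a + + 2) (m N.+ n)
    ≡⟨ progression-++ (a + + 2) m n ⟩
  progression (a + + 2) m ++ progression (a + + 2 + + (2 N.* m)) n
    ≡⟨ cong (λ b → progression (a + + 2) m ++ progression b n) (a+2+2k≡a+2[1+k] a m) ⟩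
  progression (a + + 2) m ++ progression (a + + (2 N.* suc m)) n ∎)

progression-∷ʳ : ∀ a m → progression a (suc m) ≡ progression a m ++ [ a + + (2 N.* m) ]
progression-∷ʳ a m = ≡.trans (cong (progression a) (NP.+-comm 1 m)) (progression-++ a m 1)

applyUpTo-progression : ∀ (f : ℕ → ℤ) a m → (∀ k → f k ≡ a + + (2 N.* k)) →
                        applyUpTo f m ≡ progression a m
applyUpTo-progression f a zero    f≡ = ≡.refl
applyUpTo-progression f a (suc m) f≡ = cong₂ _∷_ (≡.trans (f≡ 0) (+-identityʳ a))
  (applyUpTo-progression (λ k → f (suc k)) (a + + 2) m
    (λ k → ≡.trans (f≡ (suc k)) (sym (a+2+2k≡a+2[1+k] a k))))

interval≡progression : ∀ c n → interval c n ≡ progression (c - + n) (suc n)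
interval≡progression c n =
  ≡.trans (map-upTo _ (suc n)) (applyUpTo-progression _ (c - + n) (suc n) (λ _ → ≡.refl))

progression-nonneg : ∀ x m → All (0ℤ ≤_) (progression (+ x) m)
progression-nonneg x zero    = []
progression-nonneg x (suc m) = +≤+ N.z≤n ∷ progression-nonneg (x N.+ 2) m

-[1+k]+2[1+k]≡1+k : ∀ k → -[1+ k ] + + (2 N.* suc k) ≡ + suc k
-[1+k]+2[1+k]≡1+k k = begin
  (suc k N.+ (suc k N.+ 0)) ⊖ suc k       ≡⟨ ≤-⊖ (NP.m≤m+n (suc k) _) ⟩
  + (suc k N.+ (suc k N.+ 0) N.∸ suc k)   ≡⟨ cong +_ (NP.m+n∸m≡n (suc k) _) ⟩
  + (suc k N.+ 0)                         ≡⟨ cong +_ (NP.+-identityʳ (suc k)) ⟩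
  + suc k                                 ∎

progression-−1-centred-step : ∀ k → progression -[1+ suc (suc k) ] (suc (suc (suc k))) ≡
                                    -[1+ suc (suc k) ] ∷ progression -[1+ k ] (suc k) ++ [ + suc k ]
progression-−1-centred-step k = cong (-[1+ suc (suc k) ] ∷_) (begin
  progression -[1+ k ] (suc (suc k))
    ≡⟨ progression-∷ʳ -[1+ k ] (suc k) ⟩
  progression -[1+ k ] (suc k) ++ [ -[1+ k ] + + (2 N.* suc k) ]
    ≡⟨ cong (λ x → progression -[1+ k ] (suc k) ++ [ x ]) (-[1+k]+2[1+k]≡1+k k) ⟩
  progression -[1+ k ] (suc k) ++ [ + suc k ] ∎)

Lh̃-progression-−1-centred : ∀ k → Lh̃ (progression -[1+ k ] (suc k)) ≗ zeroCH
Lh̃-progression-−1-centred zero          j = ≡.refl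
Lh̃-progression-−1-centred (suc zero)    j =
  ≡.trans (cong (_+_ (- h 0 j)) (+-identityʳ (h 0 j))) (Lbasis-reflect 0 j)
Lh̃-progression-−1-centred (suc (suc k)) j = begin
  Lh̃ (progression -[1+ suc (suc k) ] (suc (suc (suc k)))) j
    ≡⟨ cong (λ xs → Lh̃ xs j) (progression-−1-centred-step k) ⟩
  x + Lh̃ (inner ++ [ + suc k ]) j
    ≡⟨ cong (_+_ x) (Lh̃-++ inner [ + suc k ] j) ⟩
  x + (Lh̃ inner j + (y + 0ℤ))
    ≡⟨ cong (_+_ x) (cong₂ _+_ (Lh̃-progression-−1-centred k j) (+-identityʳ y)) ⟩
  x + (0ℤ + y)
    ≡⟨ cong (_+_ x) (+-identityˡ y) ⟩
  x + y
    ≡⟨ Lbasis-reflect (suc k) j ⟩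
  0ℤ ∎
  where
  inner = progression -[1+ k ] (suc k)
  x = Lbasis -[1+ suc (suc k) ] j
  y = Lbasis (+ suc k) j

Lh̃-progression-from-negative : ∀ k m →
  Lh̃ (progression -[1+ k ] (suc k N.+ m)) ≗ Lh̃ (progression (+ suc k) m)
Lh̃-progression-from-negative k m j = begin
  Lh̃ (progression -[1+ k ] (suc k N.+ m)) j
    ≡⟨ cong (λ xs → Lh̃ xs j) (progression-++ -[1+ k ] (suc k) m) ⟩
  Lh̃ (progression -[1+ k ] (suc k) ++ progression (-[1+ k ] + + (2 N.* suc k)) m) j
    ≡⟨ Lh̃-++ (progression -[1+ k ] (suc k)) _ j ⟩
  Lh̃ (progression -[1+ k ] (suc k)) j + Lh̃ (progression (-[1+ k ] + + (2 N.* suc k)) m) j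
    ≡⟨ cong₂ _+_ (Lh̃-progression-−1-centred k j)
                 (cong (λ a → Lh̃ (progression a m) j) (-[1+k]+2[1+k]≡1+k k)) ⟩
  0ℤ + Lh̃ (progression (+ suc k) m) j
    ≡⟨ +-identityˡ _ ⟩
  Lh̃ (progression (+ suc k) m) j ∎

m⊖[1+m+k]≡-[1+k] : ∀ m k → m ⊖ suc (m N.+ k) ≡ -[1+ k ]
m⊖[1+m+k]≡-[1+k] zero    k = ≡.refl
m⊖[1+m+k]≡-[1+k] (suc m) k = ≡.trans ([1+m]⊖[1+n]≡m⊖n m (suc (m N.+ k))) (m⊖[1+m+k]≡-[1+k] m k)

Lh̃-progression-centred-nonneg : ∀ c n → CH₂⁺ (Lh̃ (progression (c ⊖ n) (suc n)))
Lh̃-progression-centred-nonneg c n with n N.≤? c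
... | yes n≤c = subst (λ a → CH₂⁺ (Lh̃ (progression a (suc n)))) (sym (⊖-≥ n≤c))
                      (Lh̃-nonneg (progression-nonneg (c N.∸ n) (suc n)))
... | no n≰c with k , ≡.refl ← NP.m≤n⇒∃[o]m+o≡n (NP.≰⇒> n≰c) =
  subst₂ (λ a m → CH₂⁺ (Lh̃ (progression a m)))
         (sym (m⊖[1+m+k]≡-[1+k] c k))
         (cong suc (≡.trans (NP.+-suc k c) (cong suc (NP.+-comm k c))))
         (CH₂⁺-resp-≗ (λ j → sym (Lh̃-progression-from-negative k (suc c) j))
                      (Lh̃-nonneg (progression-nonneg (suc k) (suc c))))

Lh̃-interval-nonneg : ∀ c n → CH₂⁺ (Lh̃ (interval (+ c) n))
Lh̃-interval-nonneg c n =
  subst (λ xs → CH₂⁺ (Lh̃ xs))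
        (sym (≡.trans (interval≡progression (+ c) n)
                      (cong (λ a → progression a (suc n)) ([+m]-[+n]≡m⊖n c n))))
        (Lh̃-progression-centred-nonneg c n)

lemma7 : (c : ℕ) (M : List ℤ) → R (+ c) M → CH₂⁺ (Lh̃ M)
lemma7 c M (ms , ns , ms≥c , _ , M↭) =
  CH₂⁺-resp-≗ (λ j → sym (Lh̃-↭ M↭ j))
    (Lh̃-++-nonneg ms _ (Lh̃-nonneg (All.map (≤-trans (+≤+ N.z≤n)) ms≥c)) (intervals-nonneg ns))
  where
  intervals-nonneg : ∀ ns → CH₂⁺ (Lh̃ (concatMap (interval (+ c)) ns))
  intervals-nonneg []       j = +≤+ N.z≤n
  intervals-nonneg (n ∷ ns) =
    Lh̃-++-nonneg (interval (+ c) n) _ (Lh̃-interval-nonneg c n) (intervals-nonneg ns)
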